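{- Let $X=\{X^1,\dots,X^m\}\subseteq\mathcal{S}_n$ and let $M_X$ be the $m\times n$ matrix whose $i$-th row is $X^i$. If the columns of $M_X$ are linearly dependent, then $X\notin E(\mathcal{S}_n)$. In particular, if $X\in E(\mathcal{S}_n)$ has exactly $n$ elements, then $X$ is linearly independent.
   Context: $\mathcal{S}_n$ is the set of nonzero tuples in $\{ -1,0,1\}^n$ whose first nonzero entry is $1$. A tuple $t\in\{1,0,-1,u\}^n$ eliminates $s\in\mathcal{S}_n$ if: (i) $t_i\neq0$ and $s_i\ne0$ for some $i$; (ii) there is $k\in\{+1,-1\}$ with $t_i=ks_i$ for all $i$ with $s_i\ne0$ and $t_i\ne0$; (iii) $s_i=0$ whenever $t_i=u$. For $X\subseteq\mathcal{S}_n$, $\mathcal{E}(X)$ is the set of elements of $\mathcal{S}_n$ eliminated by some element of $X$, and $E(\mathcal{S}_n)=\{X\subseteq\mathcal{S}_n:\mathcal{E}(X)=\mathcal{S}_n\}$, partially ordered by inclusion. -}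

module Defs where

open import Data.Nat using (ℕ; zero; suc)
open import Data.Fin using (Fin; _<_)
import Data.Fin as F
open import Data.Rational using (ℚ; 0ℚ; 1ℚ; -_; _+_; _*_)
open import Data.Product using (Σ; ∃; _×_)
open import Relation.Binary.PropositionalEquality using (_≡_; _≢_)
open import Relation.Nullary using (¬_)
open import Function.Definitions using (Injective)

data Trit : Set where
  one zero neg : Trit

data TU : Set where
  one zero neg u : TU

embed : Trit → TU
embed one  = one
embed zero = zero
embed neg  = neg

data Sign : Set where
  plus minus : Sign

_⊙_ : Sign → Trit → Trit
plus  ⊙ t    = t
minus ⊙ one  = neg
minus ⊙ zero = zero
minus ⊙ neg  = one

Tuple : ℕ → Set
Tuple n = Fin n → Trit

UTuple : ℕ → Set
UTuple n = Fin n → TU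

InS : ∀ {n} → Tuple n → Set
InS {n} s =
  (∃ λ (i : Fin n) → s i ≢ zero) ×
  (∀ (i : Fin n) → s i ≢ zero → (∀ (j : Fin n) → j < i → s j ≡ zero) → s i ≡ one)

Eliminates : ∀ {n} → UTuple n → Tuple n → Set
Eliminates {n} t s =
  (∃ λ (i : Fin n) → (t i ≢ zero) × (s i ≢ zero)) ×
  (∃ λ (k : Sign) → ∀ (i : Fin n) → s i ≢ zero → t i ≢ zero → t i ≡ embed (k ⊙ s i)) ×
  (∀ (i : Fin n) → t i ≡ u → s i ≡ zero)

IsSubsetOfS : ∀ {m n} → (Fin m → Tuple n) → Set
IsSubsetOfS {m} {n} X = Injective _≡_ _≡_ X × (∀ (i : Fin m) → InS (X i))

-- X ∈ E(S_n):  E(X) = S_n  (every element of S_n is eliminated by some element of X)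
InE : ∀ {m n} → (Fin m → Tuple n) → Set
InE {m} {n} X = ∀ (s : Tuple n) → InS s → ∃ λ (i : Fin m) → Eliminates (λ j → embed (X i j)) s

val : Trit → ℚ
val one  = 1ℚ
val zero = 0ℚ
val neg  = - 1ℚ

Σ[_] : ∀ n → (Fin n → ℚ) → ℚ
Σ[ zero ] f = 0ℚ
Σ[ suc n ] f = f F.zero + Σ[ n ] (λ i → f (F.suc i))

M : ∀ {m n} → (Fin m → Tuple n) → Fin m → Fin n → ℚ
M X i j = val (X i j)

ColumnsDependent : ∀ {m n} → (Fin m → Tuple n) → Set
ColumnsDependent {m} {n} X =
  ∃ λ (c : Fin n → ℚ) → (∃ λ (j : Fin n) → c j ≢ 0ℚ) ×
    (∀ (i : Fin m) → Σ[ n ] (λ j → c j * M X i j) ≡ 0ℚ)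

RowsIndependent : ∀ {m n} → (Fin m → Tuple n) → Set
RowsIndependent {m} {n} X =
  ∀ (c : Fin m → ℚ) → (∀ (j : Fin n) → Σ[ m ] (λ i → c i * M X i j) ≡ 0ℚ) →
    ∀ (i : Fin m) → c i ≡ 0ℚ

-- A nonzero vector c with M_X c = 0 can be scaled so that its first nonzero entry is
-- positive; then the sign vector s = sgn c lies in S_n.  If a row X^r eliminated s with
-- sign k, every term k c_j X^r_j of k (X^r · c) = 0 would be nonnegative, and the term at
-- a position where both X^r and s are nonzero would be positive: a contradiction.
-- For the second part, a square matrix with dependent rows also has dependent columns:
-- Gaussian elimination gives a nonzero c killing all rows but one, and the row
-- dependence forces c to kill that row as well.
module Submission where

open import Defs
open import Data.Nat using (ℕ; zero; suc; s≤s) renaming (_≤_ to _≤ℕ_)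
import Data.Nat.Properties as ℕ
open import Data.Fin using (Fin; punchIn; punchOut)
import Data.Fin as F
import Data.Fin.Properties as FP
open import Data.Integer using (+0; +[1+_]; -[1+_])
open import Data.Rational
  using (ℚ; mkℚ; 0ℚ; 1ℚ; -_; _+_; _*_; 1/_; _<_; _≤_; Positive; positive; ≢-nonZero)
import Data.Rational.Properties as QP
open import Data.Rational.Solver using (module +-*-Solver)
open import Algebra.Bundles using (CommutativeRing)
open import Algebra.Properties.Semiring.Sum (CommutativeRing.semiring QP.+-*-commutativeRing)
  using (sum; sum-cong-≗; sum-remove; sum-replicate-zero; ∑-distrib-+; ∑-comm; *-distribˡ-sum)
open import Data.Vec.Functional using (Vector; insertAt; removeAt)
open import Data.Vec.Functional.Properties using (insertAt-lookup; insertAt-punchIn)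
open import Data.Product using (∃; _×_; _,_)
open import Data.Sum using (_⊎_; inj₁; inj₂)
open import Data.Empty using (⊥-elim)
open import Function using (_∘_; flip)
open import Relation.Nullary using (¬_; yes; no; contradiction)
open import Relation.Binary.Definitions using (tri<; tri≈; tri>)
open import Relation.Binary.PropositionalEquality
open ≡-Reasoning
open +-*-Solver using (solve; _:=_; _:+_; _:*_; :-_)

Σ≡sum : ∀ n (f : Vector ℚ n) → Σ[ n ] f ≡ sum f
Σ≡sum zero    f = refl
Σ≡sum (suc n) f = cong (f F.zero +_) (Σ≡sum n (f ∘ F.suc))

infix 7 _·_

_·_ : ∀ {n} → Vector ℚ n → Vector ℚ n → ℚ
a · b = sum (λ j → a j * b j)

Nontrivial : ∀ {n} → Vector ℚ n → Set
Nontrivial {n} c = ∃ λ (j : Fin n) → c j ≢ 0ℚ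

Annihilates : ∀ {m n} → (Fin m → Vector ℚ n) → Vector ℚ n → Set
Annihilates A c = ∀ i → c · A i ≡ 0ℚ

zero-or-nontrivial : ∀ {n} (v : Vector ℚ n) → (∀ j → v j ≡ 0ℚ) ⊎ Nontrivial v
zero-or-nontrivial v with FP.all? (λ j → v j QP.≟ 0ℚ)
... | yes v≗0 = inj₁ v≗0
... | no ¬v≗0 = inj₂ (FP.¬∀⟶∃¬ _ _ (λ j → v j QP.≟ 0ℚ) ¬v≗0)

p*q≡0⇒q≡0 : ∀ {p q} → p ≢ 0ℚ → p * q ≡ 0ℚ → q ≡ 0ℚ
p*q≡0⇒q≡0 {p} {q} p≢0 pq≡0 = begin
  q                 ≡⟨ sym (QP.*-identityˡ q) ⟩
  1ℚ * q            ≡⟨ cong (_* q) (sym (QP.*-inverseˡ p)) ⟩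
  (1/ p) * p * q    ≡⟨ QP.*-assoc (1/ p) p q ⟩
  (1/ p) * (p * q)  ≡⟨ cong ((1/ p) *_) pq≡0 ⟩
  (1/ p) * 0ℚ       ≡⟨ QP.*-zeroʳ (1/ p) ⟩
  0ℚ                ∎
  where instance _ = ≢-nonZero p≢0

·-zeroʳ : ∀ {n} (c a : Vector ℚ n) → (∀ j → a j ≡ 0ℚ) → c · a ≡ 0ℚ
·-zeroʳ {n} c a a≗0 =
  trans (sum-cong-≗ (λ j → trans (cong (c j *_) (a≗0 j)) (QP.*-zeroʳ (c j))))
        (sum-replicate-zero n)

·-scaleˡ : ∀ {n} k (c a : Vector ℚ n) → (λ j → k * c j) · a ≡ k * (c · a)
·-scaleˡ k c a =
  trans (sum-cong-≗ (λ j → QP.*-assoc k (c j) (a j))) (sym (*-distribˡ-sum k (λ j → c j * a j)))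

·-linearʳ : ∀ {n} (c x y : Vector ℚ n) k → c · (λ j → x j + k * y j) ≡ c · x + k * (c · y)
·-linearʳ c x y k = begin
  c · (λ j → x j + k * y j)          ≡⟨ sum-cong-≗ (λ j → distrib (c j) (x j) (y j)) ⟩
  sum (λ j → cx j + k * cy j)         ≡⟨ ∑-distrib-+ cx (λ j → k * cy j) ⟩
  c · x + sum (λ j → k * cy j)        ≡⟨ cong (c · x +_) (sym (*-distribˡ-sum k cy)) ⟩
  c · x + k * (c · y)                 ∎
  where
  cx cy : Vector ℚ _
  cx j = c j * x j
  cy j = c j * y j

  distrib : ∀ a b d → a * (b + k * d) ≡ a * b + k * (a * d)
  distrib = solve 4 (λ k a b d → a :* (b :+ k :* d) := a :* b :+ k :* (a :* d)) refl k

·-insertAt : ∀ {n} (c : Vector ℚ n) p v (a : Vector ℚ (suc n)) →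
             insertAt c p v · a ≡ v * a p + c · removeAt a p
·-insertAt c p v a = trans (sum-remove {i = p} (λ j → insertAt c p v j * a j))
  (cong₂ _+_ (cong (_* a p) (insertAt-lookup c p v))
             (sum-cong-≗ (λ j → cong (_* a (punchIn p j)) (insertAt-punchIn c p v j))))

·-transpose : ∀ {m n} (A : Fin m → Vector ℚ n) (d : Vector ℚ m) (c : Vector ℚ n) →
              d · (λ r → c · A r) ≡ c · (λ j → d · flip A j)
·-transpose A d c = begin
  sum (λ r → d r * sum (λ j → c j * A r j))    ≡⟨ sum-cong-≗ (λ r → *-distribˡ-sum (d r) (cA r)) ⟩
  sum (λ r → sum (λ j → d r * (c j * A r j)))  ≡⟨ ∑-comm (λ r j → d r * (c j * A r j)) ⟩
  sum (λ j → sum (λ r → d r * (c j * A r j)))  ≡⟨ sum-cong-≗ (λ j → sum-cong-≗ (λ r → swap r j)) ⟩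
  sum (λ j → sum (λ r → c j * (d r * A r j)))  ≡⟨ sum-cong-≗ (λ j → sym (*-distribˡ-sum (c j) (dA j))) ⟩
  sum (λ j → c j * sum (λ r → d r * A r j))    ∎
  where
  cA : Fin _ → Vector ℚ _
  cA r j = c j * A r j

  dA : Fin _ → Vector ℚ _
  dA j r = d r * A r j

  swap : ∀ r j → d r * (c j * A r j) ≡ c j * (d r * A r j)
  swap r j = solve 3 (λ x y z → x :* (y :* z) := y :* (x :* z)) refl (d r) (c j) (A r j)

module Pivot {n} (r : Vector ℚ (suc n)) (p : Fin (suc n)) (rₚ≢0 : r p ≢ 0ℚ) where

  private
    instance _ = ≢-nonZero rₚ≢0

    w : ℚ
    w = 1/ r p

    w*rₚ≡1 : w * r p ≡ 1ℚ
    w*rₚ≡1 = QP.*-inverseˡ (r p)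

  eliminate : Vector ℚ (suc n) → Vector ℚ n
  eliminate a l = a (punchIn p l) + (- (a p * w)) * r (punchIn p l)

  backSubstitute : Vector ℚ n → Vector ℚ (suc n)
  backSubstitute c = insertAt c p (- ((c · removeAt r p) * w))

  backSubstitute-nontrivial : ∀ c → Nontrivial c → Nontrivial (backSubstitute c)
  backSubstitute-nontrivial c (j , cⱼ≢0) =
    punchIn p j , λ e → cⱼ≢0 (trans (sym (insertAt-punchIn c p _ j)) e)

  backSubstitute-·-pivot : ∀ c → backSubstitute c · r ≡ 0ℚ
  backSubstitute-·-pivot c = begin
    backSubstitute c · r     ≡⟨ ·-insertAt c p _ r ⟩
    (- (S * w)) * r p + S    ≡⟨ regroup S w (r p) ⟩
    S + - (S * (w * r p))    ≡⟨ cong (λ x → S + - (S * x)) w*rₚ≡1 ⟩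
    S + - (S * 1ℚ)           ≡⟨ cong (λ x → S + - x) (QP.*-identityʳ S) ⟩
    S + - S                  ≡⟨ QP.+-inverseʳ S ⟩
    0ℚ                       ∎
    where
    S = c · removeAt r p

    regroup : ∀ S w x → (- (S * w)) * x + S ≡ S + - (S * (w * x))
    regroup = solve 3 (λ S w x → (:- (S :* w)) :* x :+ S := S :+ :- (S :* (w :* x))) refl

  backSubstitute-· : ∀ c a → backSubstitute c · a ≡ c · eliminate a
  backSubstitute-· c a = begin
    backSubstitute c · a     ≡⟨ ·-insertAt c p _ a ⟩
    (- (S * w)) * a p + T    ≡⟨ regroup S w (a p) T ⟩
    T + (- (a p * w)) * S    ≡⟨ sym (·-linearʳ c (removeAt a p) (removeAt r p) (- (a p * w))) ⟩
    c · eliminate a          ∎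
    where
    S = c · removeAt r p
    T = c · removeAt a p

    regroup : ∀ S w x T → (- (S * w)) * x + T ≡ T + (- (x * w)) * S
    regroup = solve 4 (λ S w x T → (:- (S :* w)) :* x :+ T := T :+ (:- (x :* w)) :* S) refl

wide-matrix-kernel : ∀ {m n} → m ≤ℕ n → (A : Fin m → Vector ℚ (suc n)) →
              ∃ λ c → Nontrivial c × Annihilates A c
wide-matrix-kernel {zero} _ A = (λ _ → 1ℚ) , (F.zero , λ ()) , λ ()
wide-matrix-kernel {suc m} {suc n} (s≤s m≤n) A with zero-or-nontrivial (A F.zero)
... | inj₁ A₀≗0 =
  let c , c≢0 , cA≡0 = wide-matrix-kernel (ℕ.m≤n⇒m≤1+n m≤n) (A ∘ F.suc)
  in  c , c≢0 , λ { F.zero → ·-zeroʳ c _ A₀≗0 ; (F.suc i) → cA≡0 i }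
... | inj₂ (p , A₀ₚ≢0) =
  let open Pivot (A F.zero) p A₀ₚ≢0
      c , c≢0 , cA≡0 = wide-matrix-kernel m≤n (eliminate ∘ A ∘ F.suc)
  in  backSubstitute c , backSubstitute-nontrivial c c≢0 ,
      λ { F.zero    → backSubstitute-·-pivot c
        ; (F.suc i) → trans (backSubstitute-· c (A (F.suc i))) (cA≡0 i) }

annihilates-removeAt : ∀ {m n} (A : Fin (suc m) → Vector ℚ n) i c →
                       c · A i ≡ 0ℚ → Annihilates (removeAt A i) c → Annihilates A c
annihilates-removeAt A i c cAᵢ≡0 cA≡0 r with i F.≟ r
... | yes refl = cAᵢ≡0
... | no i≢r   = subst (λ r → c · A r ≡ 0ℚ) (FP.punchIn-punchOut i≢r) (cA≡0 (punchOut i≢r))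

transpose-kernel⇒kernel : ∀ {n} (A : Fin n → Vector ℚ n) →
                          (∃ λ d → Nontrivial d × Annihilates (flip A) d) →
                          ∃ λ c → Nontrivial c × Annihilates A c
transpose-kernel⇒kernel {suc n} A (d , (i , dᵢ≢0) , dA≡0)
  with wide-matrix-kernel ℕ.≤-refl (removeAt A i)
... | c , c≢0 , cA≡0 = c , c≢0 , annihilates-removeAt A i c (p*q≡0⇒q≡0 dᵢ≢0 dᵢ*cAᵢ≡0) cA≡0
  where
  cA : Vector ℚ (suc n)
  cA r = c · A r

  dᵢ*cAᵢ≡0 : d i * cA i ≡ 0ℚ
  dᵢ*cAᵢ≡0 = begin
    d i * cA i                                       ≡⟨ QP.+-identityʳ _ ⟨
    d i * cA i + 0ℚ                                  ≡⟨ cong (d i * cA i +_) (·-zeroʳ (removeAt d i) _ cA≡0) ⟨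
    d i * cA i + removeAt d i · removeAt cA i        ≡⟨ sum-remove {i = i} (λ r → d r * cA r) ⟨
    d · cA                                           ≡⟨ ·-transpose A d c ⟩
    c · (λ j → d · flip A j)                         ≡⟨ ·-zeroʳ c _ dA≡0 ⟩
    0ℚ                                               ∎

leading-nonzero : ∀ {n} (c : Vector ℚ n) → Nontrivial c →
                  ∃ λ p → c p ≢ 0ℚ × (∀ j → j F.< p → c j ≡ 0ℚ)
leading-nonzero {n} c (j , cⱼ≢0)
  with FP.¬∀⟶∃¬-smallest n (λ j → c j ≡ 0ℚ) (λ j → c j QP.≟ 0ℚ) (λ c≗0 → cⱼ≢0 (c≗0 j))
... | p , cₚ≢0 , below = p , cₚ≢0 , λ k k<p →
  subst (λ k → c k ≡ 0ℚ)
        (FP.toℕ-injective (trans (FP.toℕ-inject (F.fromℕ< k<p)) (FP.toℕ-fromℕ< k<p)))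
        (below (F.fromℕ< k<p))

sgn : ℚ → Trit
sgn (mkℚ +[1+ _ ] _ _) = one
sgn (mkℚ +0       _ _) = zero
sgn (mkℚ -[1+ _ ] _ _) = neg

sgn-positive : ∀ q → .{{Positive q}} → sgn q ≡ one
sgn-positive (mkℚ +[1+ _ ] _ _) = refl

sgn≡zero⇒≡0 : ∀ q → sgn q ≡ zero → q ≡ 0ℚ
sgn≡zero⇒≡0 (mkℚ +0 _ _) _ = QP.↥p≡0⇒p≡0 _ refl

*-sgn-positive : ∀ q → q ≢ 0ℚ → 0ℚ < q * val (sgn q)
*-sgn-positive q@(mkℚ +[1+ _ ] _ _) _ =
  subst (0ℚ <_) (sym (QP.*-identityʳ q)) (QP.positive⁻¹ q)
*-sgn-positive q@(mkℚ +0 _ _) q≢0 = contradiction (sgn≡zero⇒≡0 q refl) q≢0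
*-sgn-positive q@(mkℚ -[1+ _ ] _ _) _ =
  subst (0ℚ <_) (trans (cong -_ (sym (QP.*-identityʳ q))) (QP.neg-distribʳ-* q 1ℚ))
        (QP.neg-antimono-< (QP.negative⁻¹ q))

signℚ : Sign → ℚ
signℚ plus  = 1ℚ
signℚ minus = - 1ℚ

val-⊙ : ∀ k t → val (k ⊙ t) ≡ signℚ k * val t
val-⊙ plus  one  = refl
val-⊙ plus  zero = refl
val-⊙ plus  neg  = refl
val-⊙ minus one  = refl
val-⊙ minus zero = refl
val-⊙ minus neg  = refl

signℚ-involutive : ∀ k → signℚ k * signℚ k ≡ 1ℚ
signℚ-involutive plus  = refl
signℚ-involutive minus = refl

embed-injective : ∀ {t t′} → embed t ≡ embed t′ → t ≡ t′
embed-injective {one}  {one}  _ = refl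
embed-injective {zero} {zero} _ = refl
embed-injective {neg}  {neg}  _ = refl

zero-or-embed≢zero : ∀ t → t ≡ zero ⊎ embed t ≢ zero
zero-or-embed≢zero zero = inj₁ refl
zero-or-embed≢zero one  = inj₂ λ ()
zero-or-embed≢zero neg  = inj₂ λ ()

agreeing-term-positive : ∀ k q → q ≢ 0ℚ → 0ℚ < signℚ k * (q * val (k ⊙ sgn q))
agreeing-term-positive k q q≢0 = subst (0ℚ <_) (sym term≡) (*-sgn-positive q q≢0)
  where
  σ = signℚ k
  v = val (sgn q)
  term≡ : σ * (q * val (k ⊙ sgn q)) ≡ q * v
  term≡ = begin
    σ * (q * val (k ⊙ sgn q))  ≡⟨ cong (λ x → σ * (q * x)) (val-⊙ k (sgn q)) ⟩
    σ * (q * (σ * v))          ≡⟨ solve 3 (λ σ q v → σ :* (q :* (σ :* v)) := (σ :* σ) :* (q :* v)) refl σ q v ⟩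
    (σ * σ) * (q * v)          ≡⟨ cong (_* (q * v)) (signℚ-involutive k) ⟩
    1ℚ * (q * v)               ≡⟨ QP.*-identityˡ (q * v) ⟩
    q * v                      ∎

sum-nonneg : ∀ {n} (f : Vector ℚ n) → (∀ j → 0ℚ ≤ f j) → 0ℚ ≤ sum f
sum-nonneg {zero}  f f≥0 = QP.≤-refl
sum-nonneg {suc n} f f≥0 = QP.+-mono-≤ (f≥0 F.zero) (sum-nonneg (f ∘ F.suc) (f≥0 ∘ F.suc))

sum-positive : ∀ {n} (f : Vector ℚ n) → (∀ j → 0ℚ ≤ f j) → ∀ l → 0ℚ < f l → 0ℚ < sum f
sum-positive f f≥0 F.zero    fₗ>0 = QP.+-mono-<-≤ fₗ>0 (sum-nonneg (f ∘ F.suc) (f≥0 ∘ F.suc))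
sum-positive f f≥0 (F.suc l) fₗ>0 =
  QP.+-mono-≤-< (f≥0 F.zero) (sum-positive (f ∘ F.suc) (f≥0 ∘ F.suc) l fₗ>0)

orthogonal-sign-not-eliminated : ∀ {n} (c : Vector ℚ n) (x : Tuple n) →
                                 c · (val ∘ x) ≡ 0ℚ → ¬ Eliminates (embed ∘ x) (sgn ∘ c)
orthogonal-sign-not-eliminated c x c·x≡0 ((l , xₗ≢0 , sₗ≢0) , (k , agree) , _) =
  QP.<-irrefl (sym total≡0) (sum-positive term nonneg l (term-positive l sₗ≢0 xₗ≢0))
  where
  term : Vector ℚ _
  term j = signℚ k * (c j * val (x j))

  total≡0 : sum term ≡ 0ℚ
  total≡0 = trans (sym (*-distribˡ-sum (signℚ k) (λ j → c j * val (x j))))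
                  (trans (cong (signℚ k *_) c·x≡0) (QP.*-zeroʳ (signℚ k)))

  term-positive : ∀ j → sgn (c j) ≢ zero → embed (x j) ≢ zero → 0ℚ < term j
  term-positive j sⱼ≢0 xⱼ≢0 rewrite embed-injective (agree j sⱼ≢0 xⱼ≢0) =
    agreeing-term-positive k (c j) (sⱼ≢0 ∘ cong sgn)

  vanishing : ∀ j → c j * val (x j) ≡ 0ℚ → 0ℚ ≤ term j
  vanishing j e = QP.≤-reflexive (sym (trans (cong (signℚ k *_) e) (QP.*-zeroʳ (signℚ k))))

  nonneg : ∀ j → 0ℚ ≤ term j
  nonneg j with c j QP.≟ 0ℚ | zero-or-embed≢zero (x j)
  ... | yes cⱼ≡0 | _           = vanishing j (trans (cong (_* val (x j)) cⱼ≡0) (QP.*-zeroˡ (val (x j))))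
  ... | no  _    | inj₁ xⱼ≡0   = vanishing j (trans (cong (λ t → c j * val t) xⱼ≡0) (QP.*-zeroʳ (c j)))
  ... | no  cⱼ≢0 | inj₂ xⱼ≢0 = QP.<⇒≤ (term-positive j (cⱼ≢0 ∘ sgn≡zero⇒≡0 (c j)) xⱼ≢0)

sgn-InS : ∀ {n} (c : Vector ℚ n) p → 0ℚ < c p → (∀ j → j F.< p → c j ≡ 0ℚ) → InS (sgn ∘ c)
sgn-InS c p cₚ>0 below = (p , λ e → contradiction (trans (sym sₚ≡one) e) λ ()) , first-is-one
  where
  sₚ≡one : sgn (c p) ≡ one
  sₚ≡one = sgn-positive (c p) {{positive cₚ>0}}

  first-is-one : ∀ i → sgn (c i) ≢ zero → (∀ j → j F.< i → sgn (c j) ≡ zero) → sgn (c i) ≡ one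
  first-is-one i sᵢ≢0 zeros-before with FP.<-cmp i p
  ... | tri< i<p _ _ = contradiction (cong sgn (below i i<p)) sᵢ≢0
  ... | tri≈ _ refl _ = sₚ≡one
  ... | tri> _ _ p<i = contradiction (trans (sym sₚ≡one) (zeros-before p p<i)) λ ()

kernel⇒uneliminated-tuple : ∀ {m n} (X : Fin m → Tuple n) (c : Vector ℚ n) →
                            Nontrivial c → Annihilates (M X) c →
                            ∃ λ s → InS s × (∀ r → ¬ Eliminates (embed ∘ X r) s)
kernel⇒uneliminated-tuple X c c≢0 Xc≡0 with leading-nonzero c c≢0
... | p , cₚ≢0 , below = sgn ∘ c′ , sgn-InS c′ p c′ₚ>0 below′ , uneliminated
  where
  σ : ℚ
  σ = val (sgn (c p))

  c′ : Vector ℚ _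
  c′ j = σ * c j

  c′ₚ>0 : 0ℚ < c′ p
  c′ₚ>0 = subst (0ℚ <_) (QP.*-comm (c p) σ) (*-sgn-positive (c p) cₚ≢0)

  below′ : ∀ j → j F.< p → c′ j ≡ 0ℚ
  below′ j j<p = trans (cong (σ *_) (below j j<p)) (QP.*-zeroʳ σ)

  uneliminated : ∀ r → ¬ Eliminates (embed ∘ X r) (sgn ∘ c′)
  uneliminated r = orthogonal-sign-not-eliminated c′ (X r)
    (trans (·-scaleˡ σ c (M X r)) (trans (cong (σ *_) (Xc≡0 r)) (QP.*-zeroʳ σ)))

columnsDependent⇒¬InE : ∀ {m n} (X : Fin m → Tuple n) → ColumnsDependent X → ¬ InE X
columnsDependent⇒¬InE {n = n} X (c , c≢0 , Xc≡0) X∈E =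
  let s , s∈S , uneliminated =
        kernel⇒uneliminated-tuple X c c≢0 (λ i → trans (sym (Σ≡sum n _)) (Xc≡0 i))
      r , r-eliminates-s = X∈E s s∈S
  in  uneliminated r r-eliminates-s

inE⇒rowsIndependent : ∀ n (X : Fin n → Tuple n) → InE X → RowsIndependent X
inE⇒rowsIndependent n X X∈E d dX≡0 i with d i QP.≟ 0ℚ
... | yes dᵢ≡0 = dᵢ≡0
... | no  dᵢ≢0 =
  let c , c≢0 , Xc≡0 =
        transpose-kernel⇒kernel (M X) (d , (i , dᵢ≢0) , λ j → trans (sym (Σ≡sum n _)) (dX≡0 j))
  in  ⊥-elim (columnsDependent⇒¬InE X (c , c≢0 , λ r → trans (Σ≡sum n _) (Xc≡0 r)) X∈E)

mainTheorem4 : (∀ (m n : ℕ) (X : Fin m → Tuple n) → IsSubsetOfS X → ColumnsDependent X → ¬ InE X)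
    × (∀ (n : ℕ) (X : Fin n → Tuple n) → IsSubsetOfS X → InE X → RowsIndependent X)
mainTheorem4 = (λ m n X _ → columnsDependent⇒¬InE X) , (λ n X _ → inE⇒rowsIndependent n X)
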